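{- Let $G=(V,E)$ be a finite, simple, connected undirected graph in which every edge carries exactly one label from a finite label set $L$, and let $H_i$ be a hedge of $G$. Then $$\delta_L(V(G))-1\leq \delta_L(V(G/H_i)).$$
   Context: For each label $\ell_i$, the hedge $H_i$ is the set of edges carrying label $\ell_i$. $G/H_i$ is the graph obtained from $G$ in the following steps: 1. Contract every edge of $H_i$, so each connected component of the subgraph formed by $H_i$ becomes a single vertex. 2. Delete the resulting loops with label $\ell_i$. Loops with other labels created by the contraction are kept. 3. Clean up: parallel edges with the same label between two vertices are merged into one, and loops with the same label at a vertex are merged into one. All remaining edges keep their labels. The label degree $d_L(v)$ of a vertex $v$ in a graph (in $G$ or in $G/H_i$) is the number of distinct labels on edges, including loops, incident with $v$. $\delta_L(V(\cdot))$ denotes the minimum label degree over all vertices of the respective graph. -}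

module Defs where

open import Data.Nat using (ℕ; suc; _≤_)
open import Data.Fin using (Fin)
open import Data.Fin.Subset using (Subset; _∈_; ∣_∣)
open import Data.Maybe using (Maybe; just; nothing)
open import Data.Product using (Σ; ∃; _×_; _,_)
open import Relation.Binary.PropositionalEquality using (_≡_; _≢_)
open import Relation.Binary.Construct.Closure.ReflexiveTransitive using (Star)
open import Function.Bundles using (_⇔_)

-- A finite, simple, connected, undirected graph on vertex set Fin (suc n)
-- (nonempty), whose every edge carries exactly one label from L = Fin m.
-- lab u w ≡ just j  means: uw is an edge with label j;
-- lab u w ≡ nothing means: u and w are not adjacent.
record LabelledGraph (n m : ℕ) : Set where
  field
    lab       : Fin (suc n) → Fin (suc n) → Maybe (Fin m)
    symmetric : ∀ u w → lab u w ≡ lab w u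
    loopless  : ∀ u → lab u u ≡ nothing
  Adj : Fin (suc n) → Fin (suc n) → Set
  Adj u w = ∃ λ j → lab u w ≡ just j
  field
    connected : ∀ u w → Star Adj u w

module _ {n m : ℕ} (G : LabelledGraph n m) where
  open LabelledGraph G

  IsLabelSet : Fin (suc n) → Subset m → Set
  IsLabelSet v S = ∀ j → (j ∈ S) ⇔ (∃ λ w → lab v w ≡ just j)

  LabelDegree : Fin (suc n) → ℕ → Set
  LabelDegree v d = Σ (Subset m) λ S → IsLabelSet v S × ∣ S ∣ ≡ d

  IsMinLabelDegree : ℕ → Set
  IsMinLabelDegree δ =
    (∃ λ v → LabelDegree v δ) × (∀ v d → LabelDegree v d → δ ≤ d)

  InHedge : Fin m → Fin (suc n) → Fin (suc n) → Set
  InHedge i u w = lab u w ≡ just i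

  -- u and w lie in the same connected component of the subgraph formed by
  -- H_i (isolated vertices form singleton components); the vertices of
  -- G / H_i are these components, each represented by any of its members.
  SameComp : Fin m → Fin (suc n) → Fin (suc n) → Set
  SameComp i = Star (InHedge i)

  -- ContractedEdge i u w j : in G / H_i there is an edge (possibly a loop)
  -- with label j between the vertex (component) of u and that of w.
  -- It arises from an edge u'w' of G with label j, u' in the component of u,
  -- w' in the component of w; loops with label i are deleted, and (since all
  -- edges of label i lie inside components) so are all label-i edges.
  -- Merging parallel edges / loops of equal label does not change which
  -- (endpoints, label) triples occur.
  ContractedEdge : Fin m → Fin (suc n) → Fin (suc n) → Fin m → Set
  ContractedEdge i u w j =
    ∃ λ u' → ∃ λ w' → SameComp i u u' × SameComp i w w'
      × lab u' w' ≡ just j × j ≢ i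

  -- Label degree of the vertex [v] of G / H_i (loops included).
  IsLabelSet/ : Fin m → Fin (suc n) → Subset m → Set
  IsLabelSet/ i v S = ∀ j → (j ∈ S) ⇔ (∃ λ w → ContractedEdge i v w j)

  LabelDegree/ : Fin m → Fin (suc n) → ℕ → Set
  LabelDegree/ i v d = Σ (Subset m) λ S → IsLabelSet/ i v S × ∣ S ∣ ≡ d

  IsMinLabelDegree/ : Fin m → ℕ → Set
  IsMinLabelDegree/ i δ =
    (∃ λ v → LabelDegree/ i v δ) × (∀ v d → LabelDegree/ i v d → δ ≤ d)

-- Every label j ≢ i at a vertex v of G survives at the vertex [v] of G / H_i,
-- carried by the image of the same edge; so the label set of v is contained in
-- that of [v] together with i, and d_L(v) ≤ d_L([v]) + 1. Taking v to be a
-- representative of a vertex of minimum label degree in G / H_i gives the bound.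
module Submission where

open import Defs
open import Data.Nat using (ℕ; suc; _≤_; _∸_; _+_; z≤n; s≤s)
open import Data.Nat.Properties
  using (≤-trans; ≤-reflexive; +-suc; +-monoʳ-≤; n≤1+n; ∸-monoˡ-≤; m+n∸n≡m; module ≤-Reasoning)
open import Data.Fin using (Fin)
open import Data.Fin.Properties using (any?; _≟_)
open import Data.Fin.Subset using (Subset; _∈_; ∣_∣; _∪_; ⁅_⁆; _⊆_; inside; outside)
open import Data.Fin.Subset.Properties using (p⊆q⇒∣p∣≤∣q∣; ∣⁅x⁆∣≡1; x∈p∪q⁺; x∈⁅x⁆)
open import Data.Vec using (_∷_; []; tabulate; lookup)
open import Data.Vec.Properties using (lookup∘tabulate; lookup⇒[]=; []=⇒lookup)
open import Data.Maybe using (just)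
open import Data.Maybe.Properties using (≡-dec)
open import Data.Product using (∃; _,_)
open import Data.Sum using (inj₁; inj₂)
open import Relation.Nullary using (Dec; yes; no; does; contradiction)
open import Relation.Unary using (Pred; Decidable)
open import Relation.Binary.PropositionalEquality using (_≡_; refl; sym; trans; cong)
open import Relation.Binary.Construct.Closure.ReflexiveTransitive using (ε)
open import Function using (case_of_)
open import Function.Bundles using (_⇔_; mk⇔; Equivalence)

∣p∪q∣≤∣p∣+∣q∣ : ∀ {k} (p q : Subset k) → ∣ p ∪ q ∣ ≤ ∣ p ∣ + ∣ q ∣
∣p∪q∣≤∣p∣+∣q∣ []            []            = z≤n
∣p∪q∣≤∣p∣+∣q∣ (outside ∷ p) (outside ∷ q) = ∣p∪q∣≤∣p∣+∣q∣ p q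
∣p∪q∣≤∣p∣+∣q∣ (outside ∷ p) (inside  ∷ q) =
  ≤-trans (s≤s (∣p∪q∣≤∣p∣+∣q∣ p q)) (≤-reflexive (sym (+-suc ∣ p ∣ ∣ q ∣)))
∣p∪q∣≤∣p∣+∣q∣ (inside  ∷ p) (outside ∷ q) = s≤s (∣p∪q∣≤∣p∣+∣q∣ p q)
∣p∪q∣≤∣p∣+∣q∣ (inside  ∷ p) (inside  ∷ q) =
  s≤s (≤-trans (∣p∪q∣≤∣p∣+∣q∣ p q) (+-monoʳ-≤ ∣ p ∣ (n≤1+n ∣ q ∣)))

module _ {k ℓ} {P : Pred (Fin k) ℓ} (P? : Decidable P) where

  subsetOf : Subset k
  subsetOf = tabulate (λ j → does (P? j))

  lookup-subsetOf : ∀ j → lookup subsetOf j ≡ does (P? j)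
  lookup-subsetOf = lookup∘tabulate (λ j → does (P? j))

  ∈-subsetOf⇔ : ∀ j → j ∈ subsetOf ⇔ P j
  ∈-subsetOf⇔ j with P? j in P?j≡
  ... | yes Pj = mk⇔ (λ _ → Pj) (λ _ → lookup⇒[]= j subsetOf (trans (lookup-subsetOf j) (cong does P?j≡)))
  ... | no ¬Pj = mk⇔ (λ j∈ → case trans (sym ([]=⇒lookup j∈)) (trans (lookup-subsetOf j) (cong does P?j≡)) of λ ())
                     (λ Pj → contradiction Pj ¬Pj)

module _ {n m : ℕ} (G : LabelledGraph n m) where
  open LabelledGraph G

  incident? : ∀ v j → Dec (∃ λ w → lab v w ≡ just j)
  incident? v j = any? (λ w → ≡-dec _≟_ (lab v w) (just j))

  labelSet : Fin (suc n) → Subset m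
  labelSet v = subsetOf (incident? v)

  labelSet-isLabelSet : ∀ v → IsLabelSet G v (labelSet v)
  labelSet-isLabelSet v = ∈-subsetOf⇔ (incident? v)

  labelDegree : ∀ v → LabelDegree G v ∣ labelSet v ∣
  labelDegree v = labelSet v , labelSet-isLabelSet v , refl

  -- An edge vw of label j ≢ i survives contraction as an edge between [v] and [w].
  labelSet⊆labelSet/∪⁅i⁆ : ∀ i v {S} → IsLabelSet/ G i v S → labelSet v ⊆ S ∪ ⁅ i ⁆
  labelSet⊆labelSet/∪⁅i⁆ i v isS {j} j∈ with j ≟ i
  ... | yes refl = x∈p∪q⁺ (inj₂ (x∈⁅x⁆ i))
  ... | no j≢i with Equivalence.to (labelSet-isLabelSet v j) j∈
  ...   | w , vw:j = x∈p∪q⁺ (inj₁ (Equivalence.from (isS j) (w , v , w , ε , ε , vw:j , j≢i)))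

  labelDegree≤labelDegree/+1 : ∀ i v {d} → LabelDegree/ G i v d → ∣ labelSet v ∣ ≤ d + 1
  labelDegree≤labelDegree/+1 i v (S , isS , refl) = begin
    ∣ labelSet v ∣    ≤⟨ p⊆q⇒∣p∣≤∣q∣ (labelSet⊆labelSet/∪⁅i⁆ i v isS) ⟩
    ∣ S ∪ ⁅ i ⁆ ∣     ≤⟨ ∣p∪q∣≤∣p∣+∣q∣ S ⁅ i ⁆ ⟩
    ∣ S ∣ + ∣ ⁅ i ⁆ ∣ ≡⟨ cong (∣ S ∣ +_) (∣⁅x⁆∣≡1 i) ⟩
    ∣ S ∣ + 1         ∎
    where open ≤-Reasoning

theorem11 : (n m : ℕ) (G : LabelledGraph n m) (i : Fin m) (δ δ' : ℕ)
    → IsMinLabelDegree G δ → IsMinLabelDegree/ G i δ'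
    → δ ∸ 1 ≤ δ'
theorem11 n m G i δ δ' (_ , δ-min) ((v , v-deg/) , _) = begin
  δ ∸ 1                     ≤⟨ ∸-monoˡ-≤ 1 (δ-min v _ (labelDegree G v)) ⟩
  ∣ labelSet G v ∣ ∸ 1      ≤⟨ ∸-monoˡ-≤ 1 (labelDegree≤labelDegree/+1 G i v v-deg/) ⟩
  δ' + 1 ∸ 1                ≡⟨ m+n∸n≡m δ' 1 ⟩
  δ'                        ∎
  where open ≤-Reasoning
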